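{- Let $\varphi$ be a formula in negative normal form and let $\mathcal{W}2\mathcal{S}(\varphi)$ be its Weak-to-Safety translation. For each trace $\pi$: \begin{itemize} \item If $\pi$ is an infinite trace: $\pi \models_{t^- } \varphi \Leftrightarrow \pi \models_{LTL} \varphi$. \item If $\pi$ is a finite trace: $\pi \models_{t^- } \varphi \Leftrightarrow \pi \models_{t^- } \mathcal{W}2\mathcal{S}(\varphi)$. \end{itemize}
   Context: The logic is first-order LTL with past operators ($Y$ "yesterday", $S$ "since"), if-then-else terms, and event-freezing terms $u @\tilde{F} \varphi$ ("value of $u$ at the next point where $\varphi$ holds") and $u @\tilde{P} \varphi$ ("value of $u$ at the last point where $\varphi$ holds"), interpreted over finite or infinite traces $\pi = s_0 s_1 \dots$ of assignments to input variables $V^I$ and output variables $V^O$ (in a finite trace the last assignment is over $V^O$ only). Abbreviations: $\varphi_1 R \varphi_2 := \neg(\neg\varphi_1 U \neg\varphi_2)$, $G\varphi := \neg(\top U \neg\varphi)$. The truncated semantics (after Eisner–Fisman) has a weak relation $\models_{t^- }$ and a strong relation $\models_{t^+}$; negation swaps them ($\pi,i \models_{t^- } \neg\varphi$ iff $\pi,i \not\models_{t^+}\varphi$ and vice versa). Under weak semantics, predicates over output variables hold at any position $i \ge |\pi|$, predicates over input variables (or containing $@\tilde{F}$ terms) hold at any position $i \ge |\pi|-1$; $X\varphi$ holds at $i$ iff $\varphi$ holds at $i+1$; $\varphi_1 U \varphi_2$ holds at $i$ iff there is $k \ge i$ with $\varphi_2$ at $k$ and $\varphi_1$ at all $l$ with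 $i \le l < k$; $Y\varphi$ holds weakly at $i$ iff $i \ge |\pi|$ or ($i>0$ and $\varphi$ holds weakly at $i-1$). Consequently every formula is weakly satisfied at positions beyond the end of a finite trace. $\pi \models_{t^- } \varphi$ means $\pi,0 \models_{t^- } \varphi$. On infinite traces the weak semantics coincides with standard LTL semantics ($\models_{LTL}$) with event-freezing functions. The Weak-to-Safety translation $\mathcal{W}2\mathcal{S}$, mapping formulas in negative normal form interpreted under weak semantics into the SafetyLTL fragment, is defined by: $\mathcal{W}2\mathcal{S}(Pred) := Pred$; $\mathcal{W}2\mathcal{S}(\neg Pred) := \neg Pred$; $\mathcal{W}2\mathcal{S}(\varphi_1 \vee \varphi_2) := \mathcal{W}2\mathcal{S}(\varphi_1) \vee \mathcal{W}2\mathcal{S}(\varphi_2)$; $\mathcal{W}2\mathcal{S}(\varphi_1 \wedge \varphi_2) := \mathcal{W}2\mathcal{S}(\varphi_1) \wedge \mathcal{W}2\mathcal{S}(\varphi_2)$; $\mathcal{W}2\mathcal{S}(X\varphi) := X\,\mathcal{W}2\mathcal{S}(\varphi)$; $\mathcal{W}2\mathcal{S}(Y\varphi) := Y\,\mathcal{W}2\mathcal{S}(\varphi)$; $\mathcal{W}2\mathcal{S}(\varphi_1 U \varphi_2) := \mathcal{W}2\mathcal{S}(\varphi_2) R (\mathcal{W}2\mathcal{S}(\varphi_1) \vee \mathcal{W}2\mathcal{S}(\varphi_2))$; $\mathcal{W}2\mathcal{S}(\varphi_1 R \varphi_2) := \mathcal{W}2\mathcal{S}(\varphi_1) R\, \mathcal{W}2\mathcal{S}(\varphi_2)$.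 -}

module Defs where

open import Data.Nat using (ℕ; zero; suc; _≤_; _<_)
open import Data.Bool using (Bool; true; false; _∨_; if_then_else_)
open import Data.List using (List; []; _∷_)
open import Data.Product using (Σ; _×_; _,_)
open import Data.Sum using (_⊎_)
open import Data.Empty using (⊥)
open import Data.Unit using (⊤)
open import Relation.Nullary using (¬_)
open import Relation.Binary.PropositionalEquality using (_≡_)

-- D = domain of values, VI / VO = input / output
-- variables.  Function and predicate symbols are given directly by their
-- (fixed) interpretation; predicates are Boolean-valued.

data Term (D VI VO : Set) : Set
data Formula (D VI VO : Set) : Set

data Term D VI VO where
  ivar : VI → Term D VI VO
  ovar : VO → Term D VI VO
  fun  : (List D → D) → List (Term D VI VO) → Term D VI VO
  ite  : Formula D VI VO → Term D VI VO → Term D VI VO → Term D VI VO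
  atF  : Term D VI VO → Formula D VI VO → Term D VI VO
  atP  : Term D VI VO → Formula D VI VO → Term D VI VO

data Formula D VI VO where
  pred : (List D → Bool) → List (Term D VI VO) → Formula D VI VO
  neg  : Formula D VI VO → Formula D VI VO
  or   : Formula D VI VO → Formula D VI VO → Formula D VI VO
  and  : Formula D VI VO → Formula D VI VO → Formula D VI VO
  X    : Formula D VI VO → Formula D VI VO
  Y    : Formula D VI VO → Formula D VI VO
  U    : Formula D VI VO → Formula D VI VO → Formula D VI VO
  S    : Formula D VI VO → Formula D VI VO → Formula D VI VO

R : ∀ {D VI VO} → Formula D VI VO → Formula D VI VO → Formula D VI VO
R φ₁ φ₂ = neg (U (neg φ₁) (neg φ₂))

inT  : ∀ {D VI VO} → Term D VI VO → Bool
inTs : ∀ {D VI VO} → List (Term D VI VO) → Bool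
inF  : ∀ {D VI VO} → Formula D VI VO → Bool

inT (ivar _) = true
inT (ovar _) = false
inT (fun _ ts) = inTs ts
inT (ite c t e) = inF c ∨ (inT t ∨ inT e)
inT (atF _ _) = true
inT (atP u φ) = inT u ∨ inF φ

inTs [] = false
inTs (t ∷ ts) = inT t ∨ inTs ts

inF (pred _ ts) = inTs ts
inF (neg φ) = inF φ
inF (or φ ψ) = inF φ ∨ inF ψ
inF (and φ ψ) = inF φ ∨ inF ψ
inF (X φ) = inF φ
inF (Y φ) = inF φ
inF (U φ ψ) = inF φ ∨ inF ψ
inF (S φ ψ) = inF φ ∨ inF ψ

-- Assignments are total functions of the position; the length
-- |π| (finite n, or infinite) is recorded separately.  For a finite trace
-- of length n the positions are 0 … n-1, inputs are meaningful at
-- 0 … n-2 and outputs at 0 … n-1 (the last assignment is over V^O only);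
-- values outside that range are irrelevant junk.

record Trace (D VI VO : Set) : Set where
  field
    ins  : ℕ → VI → D
    outs : ℕ → VO → D
open Trace public

data Len : Set where
  fin : ℕ → Len
  inf : Len

BeyondO : Len → ℕ → Set
BeyondO (fin n) i = n ≤ i
BeyondO inf     i = ⊥

BeyondI : Len → ℕ → Set
BeyondI (fin n) i = n ≤ suc i
BeyondI inf     i = ⊥

InTrace : Len → ℕ → Set
InTrace (fin n) j = j < n
InTrace inf     j = ⊤

-- Truncated semantics (weak ⊨t- / strong ⊨t+).  δ gives the default
-- value of an event-freezing term when there is no point where the
-- event holds.

data Mode : Set where
  weak strong : Mode

dual : Mode → Mode
dual weak = strong
dual strong = weak

module Truncated {D VI VO : Set} (δ : Term D VI VO → D) where

  PBeyond : Len → ℕ → List (Term D VI VO) → Set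
  PBeyond len i ts = if inTs ts then BeyondI len i else BeyondO len i

  Sat  : Mode → Len → Trace D VI VO → ℕ → Formula D VI VO → Set
  YSem : Mode → Len → Trace D VI VO → ℕ → Formula D VI VO → Set
  Ev   : Mode → Len → Trace D VI VO → ℕ → Term D VI VO → D → Set
  EvL  : Mode → Len → Trace D VI VO → ℕ → List (Term D VI VO) → List D → Set

  Sat weak   len π i (pred P ts) =
    PBeyond len i ts ⊎ Σ (List D) (λ vs → EvL weak len π i ts vs × P vs ≡ true)
  Sat strong len π i (pred P ts) =
    ¬ PBeyond len i ts × Σ (List D) (λ vs → EvL strong len π i ts vs × P vs ≡ true)
  Sat m len π i (neg φ) = ¬ Sat (dual m) len π i φ
  Sat m len π i (or φ ψ) = Sat m len π i φ ⊎ Sat m len π i ψ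
  Sat m len π i (and φ ψ) = Sat m len π i φ × Sat m len π i ψ
  Sat m len π i (X φ) = Sat m len π (suc i) φ
  Sat m len π i (Y φ) = YSem m len π i φ
  Sat m len π i (U φ ψ) =
    Σ ℕ λ k → i ≤ k × Sat m len π k ψ × (∀ l → i ≤ l → l < k → Sat m len π l φ)
  Sat m len π i (S φ ψ) =
    Σ ℕ λ k → k ≤ i × Sat m len π k ψ × (∀ l → k < l → l ≤ i → Sat m len π l φ)

  YSem weak   len π zero    φ = BeyondO len zero
  YSem weak   len π (suc i) φ = BeyondO len (suc i) ⊎ Sat weak len π i φ
  YSem strong len π zero    φ = ⊥
  YSem strong len π (suc i) φ = ¬ BeyondO len (suc i) × Sat strong len π i φ

  Ev m len π i (ivar x) v = v ≡ ins π i x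
  Ev m len π i (ovar x) v = v ≡ outs π i x
  Ev m len π i (fun f ts) v = Σ (List D) λ vs → EvL m len π i ts vs × v ≡ f vs
  Ev m len π i (ite c t e) v =
    (Sat m len π i c × Ev m len π i t v) ⊎ (¬ Sat m len π i c × Ev m len π i e v)
  Ev m len π i (atF u φ) v =
    (Σ ℕ λ j → i < j × InTrace len j × Sat m len π j φ
        × (∀ l → i < l → l < j → ¬ Sat m len π l φ) × Ev m len π j u v)
    ⊎ ((∀ j → i < j → InTrace len j → ¬ Sat m len π j φ) × v ≡ δ (atF u φ))
  Ev m len π i (atP u φ) v =
    (Σ ℕ λ j → j < i × Sat m len π j φ
        × (∀ l → j < l → l < i → ¬ Sat m len π l φ) × Ev m len π j u v)
    ⊎ ((∀ j → j < i → ¬ Sat m len π j φ) × v ≡ δ (atP u φ))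

  EvL m len π i [] vs = vs ≡ []
  EvL m len π i (t ∷ ts) [] = ⊥
  EvL m len π i (t ∷ ts) (v ∷ vs) = Ev m len π i t v × EvL m len π i ts vs

  _⊨t-_ : (Len × Trace D VI VO) → Formula D VI VO → Set
  (len , π) ⊨t- φ = Sat weak len π 0 φ

module LTL {D VI VO : Set} (δ : Term D VI VO → D) where

  Sat  : Trace D VI VO → ℕ → Formula D VI VO → Set
  YSem : Trace D VI VO → ℕ → Formula D VI VO → Set
  Ev   : Trace D VI VO → ℕ → Term D VI VO → D → Set
  EvL  : Trace D VI VO → ℕ → List (Term D VI VO) → List D → Set

  Sat π i (pred P ts) = Σ (List D) (λ vs → EvL π i ts vs × P vs ≡ true)
  Sat π i (neg φ) = ¬ Sat π i φ
  Sat π i (or φ ψ) = Sat π i φ ⊎ Sat π i ψ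
  Sat π i (and φ ψ) = Sat π i φ × Sat π i ψ
  Sat π i (X φ) = Sat π (suc i) φ
  Sat π i (Y φ) = YSem π i φ
  Sat π i (U φ ψ) =
    Σ ℕ λ k → i ≤ k × Sat π k ψ × (∀ l → i ≤ l → l < k → Sat π l φ)
  Sat π i (S φ ψ) =
    Σ ℕ λ k → k ≤ i × Sat π k ψ × (∀ l → k < l → l ≤ i → Sat π l φ)

  YSem π zero    φ = ⊥
  YSem π (suc i) φ = Sat π i φ

  Ev π i (ivar x) v = v ≡ ins π i x
  Ev π i (ovar x) v = v ≡ outs π i x
  Ev π i (fun f ts) v = Σ (List D) λ vs → EvL π i ts vs × v ≡ f vs
  Ev π i (ite c t e) v = (Sat π i c × Ev π i t v) ⊎ (¬ Sat π i c × Ev π i e v)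
  Ev π i (atF u φ) v =
    (Σ ℕ λ j → i < j × Sat π j φ × (∀ l → i < l → l < j → ¬ Sat π l φ) × Ev π j u v)
    ⊎ ((∀ j → i < j → ¬ Sat π j φ) × v ≡ δ (atF u φ))
  Ev π i (atP u φ) v =
    (Σ ℕ λ j → j < i × Sat π j φ × (∀ l → j < l → l < i → ¬ Sat π l φ) × Ev π j u v)
    ⊎ ((∀ j → j < i → ¬ Sat π j φ) × v ≡ δ (atP u φ))

  EvL π i [] vs = vs ≡ []
  EvL π i (t ∷ ts) [] = ⊥
  EvL π i (t ∷ ts) (v ∷ vs) = Ev π i t v × EvL π i ts vs

  _⊨LTL_ : Trace D VI VO → Formula D VI VO → Set
  π ⊨LTL φ = Sat π 0 φ

data NNF (D VI VO : Set) : Set where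
  npred    : (List D → Bool) → List (Term D VI VO) → NNF D VI VO
  nnegpred : (List D → Bool) → List (Term D VI VO) → NNF D VI VO
  nor      : NNF D VI VO → NNF D VI VO → NNF D VI VO
  nand     : NNF D VI VO → NNF D VI VO → NNF D VI VO
  nX       : NNF D VI VO → NNF D VI VO
  nY       : NNF D VI VO → NNF D VI VO
  nU       : NNF D VI VO → NNF D VI VO → NNF D VI VO
  nR       : NNF D VI VO → NNF D VI VO → NNF D VI VO

⌜_⌝ : ∀ {D VI VO} → NNF D VI VO → Formula D VI VO
⌜ npred P ts ⌝ = pred P ts
⌜ nnegpred P ts ⌝ = neg (pred P ts)
⌜ nor φ ψ ⌝ = or ⌜ φ ⌝ ⌜ ψ ⌝
⌜ nand φ ψ ⌝ = and ⌜ φ ⌝ ⌜ ψ ⌝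
⌜ nX φ ⌝ = X ⌜ φ ⌝
⌜ nY φ ⌝ = Y ⌜ φ ⌝
⌜ nU φ ψ ⌝ = U ⌜ φ ⌝ ⌜ ψ ⌝
⌜ nR φ ψ ⌝ = R ⌜ φ ⌝ ⌜ ψ ⌝

W2S : ∀ {D VI VO} → NNF D VI VO → NNF D VI VO
W2S (npred P ts) = npred P ts
W2S (nnegpred P ts) = nnegpred P ts
W2S (nor φ ψ) = nor (W2S φ) (W2S ψ)
W2S (nand φ ψ) = nand (W2S φ) (W2S ψ)
W2S (nX φ) = nX (W2S φ)
W2S (nY φ) = nY (W2S φ)
W2S (nU φ ψ) = nR (W2S ψ) (nor (W2S φ) (W2S ψ))
W2S (nR φ ψ) = nR (W2S φ) (W2S ψ)

module Submission where

-- On an infinite trace no position lies beyond the end, so the truncated and the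
-- standard semantics agree clause by clause.  On a finite trace of length n every
-- formula holds weakly (and fails strongly) from position n on.  Hence ψ eventually
-- holds weakly, and under that proviso φ U ψ is equivalent to ψ R (φ ∨ ψ); the
-- converse direction picks the first position where ψ holds, which is constructive
-- because the truncated semantics is decidable on finite traces: every witness of
-- an until can be moved into [i, i + n], and every term has exactly one value.

open import Defs
open import Data.Nat using (ℕ; zero; suc; _+_; _≤_; _<_; s≤s; s≤s⁻¹; _≤?_)
open import Data.Nat.Properties
  using ( ≤-refl; ≤-trans; <-trans; <⇒≤; <-cmp; ≰⇒>; ≤⇒≯; <⇒≱; m≤n⇒m≤1+n
        ; m≤n⇒m<n∨m≡n; m<1+n⇒m<n∨m≡n; m≤m+n; m≤n+m; anyUpTo?; allUpTo?)
open import Data.Bool using (Bool; true; false; if_then_else_)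
open import Data.Bool.Properties using () renaming (_≟_ to _≟ᵇ_)
open import Data.List using ([]; _∷_)
open import Data.Product using (∃; ∃!; _×_; _,_)
open import Data.Product.Function.NonDependent.Propositional using (_×-⇔_)
open import Data.Sum using (_⊎_; inj₁; inj₂; [_,_])
open import Data.Sum.Function.Propositional using (_⊎-⇔_)
open import Data.Empty using (⊥-elim)
open import Data.Unit using (⊤; tt)
open import Function.Bundles using (_⇔_; mk⇔; Equivalence)
open import Function.Construct.Identity using (⇔-id)
open import Function.Construct.Composition using (_⇔-∘_)
open import Function.Related.TypeIsomorphisms using (→-cong-⇔; ¬-cong-⇔)
open import Relation.Nullary using (¬_; Dec; yes; no)
open import Relation.Nullary.Decidable using (¬?; _×-dec_; _⊎-dec_; _→-dec_; map′)
open import Relation.Unary using (Decidable)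
open import Relation.Binary using (tri<; tri≈; tri>)
open import Relation.Binary.PropositionalEquality using (_≡_; refl; sym; trans; cong; cong₂; subst)

open Equivalence

∃-cong-⇔ : {X : Set} {A B : X → Set} → (∀ x → A x ⇔ B x) → ∃ A ⇔ ∃ B
∃-cong-⇔ A⇔B = mk⇔ (λ (x , a) → x , to (A⇔B x) a) (λ (x , b) → x , from (A⇔B x) b)

∀-cong-⇔ : {X : Set} {A B : X → Set} → (∀ x → A x ⇔ B x) → (∀ x → A x) ⇔ (∀ x → B x)
∀-cong-⇔ A⇔B = mk⇔ (λ f x → to (A⇔B x) (f x)) (λ f x → from (A⇔B x) (f x))

guarded-∀-cong-⇔ : {P Q A B : ℕ → Set} → (∀ l → A l ⇔ B l) →
                   (∀ l → P l → Q l → A l) ⇔ (∀ l → P l → Q l → B l)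
guarded-∀-cong-⇔ A⇔B = ∀-cong-⇔ λ l → →-cong-⇔ (⇔-id _) (→-cong-⇔ (⇔-id _) (A⇔B l))

witness-cong-⇔ : {G : ℕ → Set} {P Q : ℕ → ℕ → Set} {A A′ B B′ : ℕ → Set} →
                 (∀ l → A l ⇔ A′ l) → (∀ k → B k ⇔ B′ k) →
                 (∃ λ k → G k × B k × (∀ l → P k l → Q k l → A l)) ⇔
                 (∃ λ k → G k × B′ k × (∀ l → P k l → Q k l → A′ l))
witness-cong-⇔ A⇔A′ B⇔B′ = ∃-cong-⇔ λ k → ⇔-id _ ×-⇔ B⇔B′ k ×-⇔ guarded-∀-cong-⇔ A⇔A′

if-intro : {A B : Set} (b : Bool) → A → B → if b then A else B
if-intro true a _ = a
if-intro false _ b = b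

if-elim : {A B C : Set} (b : Bool) → (A → C) → (B → C) → if b then A else B → C
if-elim true f _ = f
if-elim false _ g = g

if-dec : {A B : Set} (b : Bool) → Dec A → Dec B → Dec (if b then A else B)
if-dec true a? _ = a?
if-dec false _ b? = b?

∃-unique-dec : {A : Set} {B P : A → Set} → ∃! _≡_ B → Decidable P → Dec (∃ λ x → B x × P x)
∃-unique-dec {P = P} (x , bx , unique) P? with P? x
... | yes px = yes (x , bx , px)
... | no ¬px = no λ (y , by , py) → ¬px (subst P (sym (unique by)) py)

between? : {P : ℕ → Set} → Decidable P → ∀ i k → Dec (∀ l → i ≤ l → l < k → P l)
between? P? i k =
  map′ (λ all l i≤l l<k → all l<k i≤l) (λ all {l} l<k i≤l → all l i≤l l<k)
       (allUpTo? (λ l → (i ≤? l) →-dec P? l) k)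

module _ {Q : ℕ → Set} (Q? : Decidable Q) where

  first-from : ∀ i n →
    (∃ λ j → i ≤ j × j < n × Q j × (∀ l → i ≤ l → l < j → ¬ Q l)) ⊎ (∀ j → i ≤ j → j < n → ¬ Q j)
  first-from i zero = inj₂ λ _ _ ()
  first-from i (suc n) with first-from i n
  ... | inj₁ (j , i≤j , j<n , q , before) = inj₁ (j , i≤j , m≤n⇒m≤1+n j<n , q , before)
  ... | inj₂ none with (i ≤? n) ×-dec Q? n
  ...   | yes (i≤n , q) = inj₁ (n , i≤n , ≤-refl , q , none)
  ...   | no ¬here = inj₂ none′
    where
    none′ : ∀ j → i ≤ j → j < suc n → ¬ Q j
    none′ j i≤j j<1+n with m<1+n⇒m<n∨m≡n j<1+n
    ... | inj₁ j<n = none j i≤j j<n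
    ... | inj₂ refl = λ q → ¬here (i≤j , q)

  last-before : ∀ i →
    (∃ λ j → j < i × Q j × (∀ l → j < l → l < i → ¬ Q l)) ⊎ (∀ j → j < i → ¬ Q j)
  last-before zero = inj₂ λ _ ()
  last-before (suc i) with Q? i
  ... | yes q = inj₁ (i , ≤-refl , q , λ l i<l l<1+i → ⊥-elim (<⇒≱ i<l (s≤s⁻¹ l<1+i)))
  ... | no ¬q with last-before i
  ...   | inj₁ (j , j<i , q , after) = inj₁ (j , m≤n⇒m≤1+n j<i , q , after′)
    where
    after′ : ∀ l → j < l → l < suc i → ¬ Q l
    after′ l j<l l<1+i with m<1+n⇒m<n∨m≡n l<1+i
    ... | inj₁ l<i = after l j<l l<i
    ... | inj₂ refl = ¬q
  ...   | inj₂ none = inj₂ none′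
    where
    none′ : ∀ j → j < suc i → ¬ Q j
    none′ j j<1+i with m<1+n⇒m<n∨m≡n j<1+i
    ... | inj₁ j<i = none j j<i
    ... | inj₂ refl = ¬q

first-unique : {Q : ℕ → Set} {i j j′ : ℕ} →
  i ≤ j → Q j → (∀ l → i ≤ l → l < j → ¬ Q l) →
  i ≤ j′ → Q j′ → (∀ l → i ≤ l → l < j′ → ¬ Q l) → j ≡ j′
first-unique {j = j} {j′} i≤j q before i≤j′ q′ before′ with <-cmp j j′
... | tri< j<j′ _ _ = ⊥-elim (before′ j i≤j j<j′ q)
... | tri≈ _ j≡j′ _ = j≡j′
... | tri> _ _ j′<j = ⊥-elim (before j′ i≤j′ j′<j q′)

last-unique : {Q : ℕ → Set} {i j j′ : ℕ} →
  j < i → Q j → (∀ l → j < l → l < i → ¬ Q l) →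
  j′ < i → Q j′ → (∀ l → j′ < l → l < i → ¬ Q l) → j ≡ j′
last-unique {j = j} {j′} j<i q after j′<i q′ after′ with <-cmp j j′
... | tri< j<j′ _ _ = ⊥-elim (after j′ j<j′ j′<i q′)
... | tri≈ _ j≡j′ _ = j≡j′
... | tri> _ _ j′<j = ⊥-elim (after′ j j′<j j<i q)

module Infinite {D VI VO : Set} (δ : Term D VI VO → D) (π : Trace D VI VO) where
  private
    module T = Truncated δ
    module L = LTL δ

  ¬beyond : ∀ i ts → ¬ T.PBeyond inf i ts
  ¬beyond i ts = if-elim (inTs ts) (λ ()) (λ ())

  truncated⇔LTL : ∀ m i φ → T.Sat m inf π i φ ⇔ L.Sat π i φ
  Ev⇔ : ∀ m i t v → T.Ev m inf π i t v ⇔ L.Ev π i t v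
  EvL⇔ : ∀ m i ts vs → T.EvL m inf π i ts vs ⇔ L.EvL π i ts vs

  truncated⇔LTL weak i (pred P ts) = mk⇔
    [ (λ b → ⊥-elim (¬beyond i ts b)) , (λ (vs , e , p) → vs , to (EvL⇔ weak i ts vs) e , p) ]
    (λ (vs , e , p) → inj₂ (vs , from (EvL⇔ weak i ts vs) e , p))
  truncated⇔LTL strong i (pred P ts) = mk⇔
    (λ (_ , vs , e , p) → vs , to (EvL⇔ strong i ts vs) e , p)
    (λ (vs , e , p) → ¬beyond i ts , vs , from (EvL⇔ strong i ts vs) e , p)
  truncated⇔LTL weak i (neg φ) = ¬-cong-⇔ (truncated⇔LTL strong i φ)
  truncated⇔LTL strong i (neg φ) = ¬-cong-⇔ (truncated⇔LTL weak i φ)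
  truncated⇔LTL weak i (or φ ψ) = truncated⇔LTL weak i φ ⊎-⇔ truncated⇔LTL weak i ψ
  truncated⇔LTL strong i (or φ ψ) = truncated⇔LTL strong i φ ⊎-⇔ truncated⇔LTL strong i ψ
  truncated⇔LTL weak i (and φ ψ) = truncated⇔LTL weak i φ ×-⇔ truncated⇔LTL weak i ψ
  truncated⇔LTL strong i (and φ ψ) = truncated⇔LTL strong i φ ×-⇔ truncated⇔LTL strong i ψ
  truncated⇔LTL weak i (X φ) = truncated⇔LTL weak (suc i) φ
  truncated⇔LTL strong i (X φ) = truncated⇔LTL strong (suc i) φ
  truncated⇔LTL weak zero (Y φ) = ⇔-id _
  truncated⇔LTL weak (suc i) (Y φ) =
    mk⇔ [ (λ ()) , to (truncated⇔LTL weak i φ) ] (λ s → inj₂ (from (truncated⇔LTL weak i φ) s))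
  truncated⇔LTL strong zero (Y φ) = ⇔-id _
  truncated⇔LTL strong (suc i) (Y φ) =
    mk⇔ (λ (_ , s) → to (truncated⇔LTL strong i φ) s) (λ s → (λ ()) , from (truncated⇔LTL strong i φ) s)
  truncated⇔LTL weak i (U φ ψ) =
    witness-cong-⇔ (λ l → truncated⇔LTL weak l φ) (λ k → truncated⇔LTL weak k ψ)
  truncated⇔LTL strong i (U φ ψ) =
    witness-cong-⇔ (λ l → truncated⇔LTL strong l φ) (λ k → truncated⇔LTL strong k ψ)
  truncated⇔LTL weak i (S φ ψ) =
    witness-cong-⇔ (λ l → truncated⇔LTL weak l φ) (λ k → truncated⇔LTL weak k ψ)
  truncated⇔LTL strong i (S φ ψ) =
    witness-cong-⇔ (λ l → truncated⇔LTL strong l φ) (λ k → truncated⇔LTL strong k ψ)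

  Ev⇔ m i (ivar x) v = ⇔-id _
  Ev⇔ m i (ovar x) v = ⇔-id _
  Ev⇔ m i (fun f ts) v = ∃-cong-⇔ λ vs → EvL⇔ m i ts vs ×-⇔ ⇔-id _
  Ev⇔ m i (ite c t e) v =
    (truncated⇔LTL m i c ×-⇔ Ev⇔ m i t v) ⊎-⇔ (¬-cong-⇔ (truncated⇔LTL m i c) ×-⇔ Ev⇔ m i e v)
  Ev⇔ m i (atF u φ) v =
    (∃-cong-⇔ λ j → ⇔-id _ ×-⇔ ⊤×-⇔ (truncated⇔LTL m j φ
                    ×-⇔ guarded-∀-cong-⇔ (λ l → ¬-cong-⇔ (truncated⇔LTL m l φ)) ×-⇔ Ev⇔ m j u v))
    ⊎-⇔ (∀-cong-⇔ (λ j → →-cong-⇔ (⇔-id _) (⊤→-⇔ (¬-cong-⇔ (truncated⇔LTL m j φ)))) ×-⇔ ⇔-id _)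
    where
    ⊤×-⇔ : {A B : Set} → A ⇔ B → (⊤ × A) ⇔ B
    ⊤×-⇔ A⇔B = mk⇔ (λ (_ , a) → to A⇔B a) (λ b → tt , from A⇔B b)
    ⊤→-⇔ : {A B : Set} → A ⇔ B → (⊤ → A) ⇔ B
    ⊤→-⇔ A⇔B = mk⇔ (λ f → to A⇔B (f tt)) (λ b _ → from A⇔B b)
  Ev⇔ m i (atP u φ) v =
    (∃-cong-⇔ λ j → ⇔-id _ ×-⇔ truncated⇔LTL m j φ
                    ×-⇔ guarded-∀-cong-⇔ (λ l → ¬-cong-⇔ (truncated⇔LTL m l φ)) ×-⇔ Ev⇔ m j u v)
    ⊎-⇔ (∀-cong-⇔ (λ j → →-cong-⇔ (⇔-id _) (¬-cong-⇔ (truncated⇔LTL m j φ))) ×-⇔ ⇔-id _)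

  EvL⇔ m i [] vs = ⇔-id _
  EvL⇔ m i (t ∷ ts) [] = ⇔-id _
  EvL⇔ m i (t ∷ ts) (v ∷ vs) = Ev⇔ m i t v ×-⇔ EvL⇔ m i ts vs

module Finite {D VI VO : Set} (δ : Term D VI VO → D) (π : Trace D VI VO) (n : ℕ) where
  open Truncated δ

  beyond-past-end : ∀ {i} ts → n ≤ i → PBeyond (fin n) i ts
  beyond-past-end ts n≤i = if-intro (inTs ts) (m≤n⇒m≤1+n n≤i) n≤i

  PBeyond? : ∀ i ts → Dec (PBeyond (fin n) i ts)
  PBeyond? i ts = if-dec (inTs ts) (n ≤? suc i) (n ≤? i)

  weak-past-end : ∀ {i} φ → n ≤ i → Sat weak (fin n) π i φ
  strong-past-end : ∀ {i} φ → n ≤ i → ¬ Sat strong (fin n) π i φ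

  weak-past-end (pred P ts) n≤i = inj₁ (beyond-past-end ts n≤i)
  weak-past-end (neg φ) n≤i = strong-past-end φ n≤i
  weak-past-end (or φ ψ) n≤i = inj₁ (weak-past-end φ n≤i)
  weak-past-end (and φ ψ) n≤i = weak-past-end φ n≤i , weak-past-end ψ n≤i
  weak-past-end (X φ) n≤i = weak-past-end φ (m≤n⇒m≤1+n n≤i)
  weak-past-end {zero} (Y φ) n≤i = n≤i
  weak-past-end {suc i} (Y φ) n≤i = inj₁ n≤i
  weak-past-end {i} (U φ ψ) n≤i = i , ≤-refl , weak-past-end ψ n≤i , λ l i≤l l<i → ⊥-elim (≤⇒≯ i≤l l<i)
  weak-past-end {i} (S φ ψ) n≤i = i , ≤-refl , weak-past-end ψ n≤i , λ l i<l l≤i → ⊥-elim (<⇒≱ i<l l≤i)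

  strong-past-end (pred P ts) n≤i (¬beyond , _) = ¬beyond (beyond-past-end ts n≤i)
  strong-past-end (neg φ) n≤i ¬sat = ¬sat (weak-past-end φ n≤i)
  strong-past-end (or φ ψ) n≤i = [ strong-past-end φ n≤i , strong-past-end ψ n≤i ]
  strong-past-end (and φ ψ) n≤i (s , _) = strong-past-end φ n≤i s
  strong-past-end (X φ) n≤i = strong-past-end φ (m≤n⇒m≤1+n n≤i)
  strong-past-end {suc i} (Y φ) n≤i (¬past-end , _) = ¬past-end n≤i
  strong-past-end (U φ ψ) n≤i (k , i≤k , s , _) = strong-past-end ψ (≤-trans n≤i i≤k) s
  strong-past-end {i} (S φ ψ) n≤i (k , k≤i , s , gap) with m≤n⇒m<n∨m≡n k≤i
  ... | inj₁ k<i = strong-past-end φ n≤i (gap i k<i ≤-refl)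
  ... | inj₂ refl = strong-past-end ψ n≤i s

  -- The bodies of the U and S clauses of Sat, which does not unfold on a variable mode.
  UntilWitness SinceWitness : Mode → ℕ → Formula D VI VO → Formula D VI VO → ℕ → Set
  UntilWitness m i φ ψ k = i ≤ k × Sat m (fin n) π k ψ × (∀ l → i ≤ l → l < k → Sat m (fin n) π l φ)
  SinceWitness m i φ ψ k = k ≤ i × Sat m (fin n) π k ψ × (∀ l → k < l → l ≤ i → Sat m (fin n) π l φ)

  until-witness-bounded : ∀ m {i} φ ψ → ∃ (UntilWitness m i φ ψ) →
                          ∃ λ k → k < suc (i + n) × UntilWitness m i φ ψ k
  until-witness-bounded weak {i} φ ψ (k , i≤k , s , gap) with k ≤? i + n
  ... | yes k≤i+n = k , s≤s k≤i+n , i≤k , s , gap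
  ... | no k≰i+n =
    i + n , ≤-refl , m≤m+n i n , weak-past-end ψ (m≤n+m n i) ,
    λ l i≤l l<i+n → gap l i≤l (<-trans l<i+n (≰⇒> k≰i+n))
  until-witness-bounded strong {i} φ ψ (k , i≤k , s , gap) = k , s≤s k≤i+n , i≤k , s , gap
    where
    k≤i+n : k ≤ i + n
    k≤i+n = ≤-trans (<⇒≤ (≰⇒> λ n≤k → strong-past-end ψ n≤k s)) (m≤n+m n i)

  Sat? : ∀ m i φ → Dec (Sat m (fin n) π i φ)
  Sat?-until : ∀ m i φ ψ → Dec (∃ (UntilWitness m i φ ψ))
  Sat?-since : ∀ m i φ ψ → Dec (∃ (SinceWitness m i φ ψ))
  Ev-∃! : ∀ m i t → ∃! _≡_ (Ev m (fin n) π i t)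
  EvL-∃! : ∀ m i ts → ∃! _≡_ (EvL m (fin n) π i ts)

  Sat? weak i (pred P ts) =
    PBeyond? i ts ⊎-dec ∃-unique-dec (EvL-∃! weak i ts) (λ vs → P vs ≟ᵇ true)
  Sat? strong i (pred P ts) =
    ¬? (PBeyond? i ts) ×-dec ∃-unique-dec (EvL-∃! strong i ts) (λ vs → P vs ≟ᵇ true)
  Sat? weak i (neg φ) = ¬? (Sat? strong i φ)
  Sat? strong i (neg φ) = ¬? (Sat? weak i φ)
  Sat? weak i (or φ ψ) = Sat? weak i φ ⊎-dec Sat? weak i ψ
  Sat? strong i (or φ ψ) = Sat? strong i φ ⊎-dec Sat? strong i ψ
  Sat? weak i (and φ ψ) = Sat? weak i φ ×-dec Sat? weak i ψ
  Sat? strong i (and φ ψ) = Sat? strong i φ ×-dec Sat? strong i ψ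
  Sat? weak i (X φ) = Sat? weak (suc i) φ
  Sat? strong i (X φ) = Sat? strong (suc i) φ
  Sat? weak zero (Y φ) = n ≤? zero
  Sat? weak (suc i) (Y φ) = (n ≤? suc i) ⊎-dec Sat? weak i φ
  Sat? strong zero (Y φ) = no λ ()
  Sat? strong (suc i) (Y φ) = ¬? (n ≤? suc i) ×-dec Sat? strong i φ
  Sat? weak i (U φ ψ) = Sat?-until weak i φ ψ
  Sat? strong i (U φ ψ) = Sat?-until strong i φ ψ
  Sat? weak i (S φ ψ) = Sat?-since weak i φ ψ
  Sat? strong i (S φ ψ) = Sat?-since strong i φ ψ

  Sat?-until m i φ ψ =
    map′ (λ (k , _ , w) → k , w) (until-witness-bounded m φ ψ)
         (anyUpTo? (λ k → (i ≤? k) ×-dec Sat? m k ψ ×-dec between? (λ l → Sat? m l φ) i k)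
                   (suc (i + n)))

  Sat?-since m i φ ψ =
    map′ (λ (k , k<1+i , w) → k , s≤s⁻¹ k<1+i , w) (λ (k , k≤i , w) → k , s≤s k≤i , w)
         (anyUpTo? (λ k → Sat? m k ψ ×-dec
                      map′ (λ g l k<l l≤i → g l k<l (s≤s l≤i)) (λ g l k<l l<1+i → g l k<l (s≤s⁻¹ l<1+i))
                           (between? (λ l → Sat? m l φ) (suc k) (suc i)))
                   (suc i))

  Ev-∃! m i (ivar x) = ins π i x , refl , sym
  Ev-∃! m i (ovar x) = outs π i x , refl , sym
  Ev-∃! m i (fun f ts) with EvL-∃! m i ts
  ... | vs , evs , unique =
    f vs , (vs , evs , refl) , λ (_ , evs′ , v≡) → trans (cong f (unique evs′)) (sym v≡)
  Ev-∃! m i (ite c t e) with Sat? m i c | Ev-∃! m i t | Ev-∃! m i e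
  ... | yes sc | v , ev , unique | _ =
    v , inj₁ (sc , ev) , [ (λ (_ , ev′) → unique ev′) , (λ (¬sc , _) → ⊥-elim (¬sc sc)) ]
  ... | no ¬sc | _ | v , ev , unique =
    v , inj₂ (¬sc , ev) , [ (λ (sc , _) → ⊥-elim (¬sc sc)) , (λ (_ , ev′) → unique ev′) ]
  Ev-∃! m i (atF u φ) with first-from (λ j → Sat? m j φ) (suc i) n
  ... | inj₂ none =
    δ (atF u φ) , inj₂ (none , refl) ,
    [ (λ (j , i<j , j<n , s , _) → ⊥-elim (none j i<j j<n s)) , (λ (_ , v≡) → sym v≡) ]
  ... | inj₁ (j , i<j , j<n , s , before) with Ev-∃! m j u
  ...   | v , ev , unique =
    v , inj₁ (j , i<j , j<n , s , before , ev) ,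
    [ (λ (j′ , i<j′ , _ , s′ , before′ , ev′) →
         unique (subst (λ k → Ev m (fin n) π k u _) (sym (first-unique i<j s before i<j′ s′ before′)) ev′))
    , (λ (none , _) → ⊥-elim (none j i<j j<n s)) ]
  Ev-∃! m i (atP u φ) with last-before (λ j → Sat? m j φ) i
  ... | inj₂ none =
    δ (atP u φ) , inj₂ (none , refl) ,
    [ (λ (j , j<i , s , _) → ⊥-elim (none j j<i s)) , (λ (_ , v≡) → sym v≡) ]
  ... | inj₁ (j , j<i , s , after) with Ev-∃! m j u
  ...   | v , ev , unique =
    v , inj₁ (j , j<i , s , after , ev) ,
    [ (λ (j′ , j′<i , s′ , after′ , ev′) →
         unique (subst (λ k → Ev m (fin n) π k u _) (sym (last-unique j<i s after j′<i s′ after′)) ev′))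
    , (λ (none , _) → ⊥-elim (none j j<i s)) ]

  EvL-∃! m i [] = [] , refl , sym
  EvL-∃! m i (t ∷ ts) with Ev-∃! m i t | EvL-∃! m i ts
  ... | v , ev , unique | vs , evs , uniques =
    v ∷ vs , (ev , evs) , λ { {[]} () ; {_ ∷ _} (ev′ , evs′) → cong₂ _∷_ (unique ev′) (uniques evs′) }

  until⇔release : ∀ i (φ ψ : Formula D VI VO) →
                  Sat weak (fin n) π i (U φ ψ) ⇔ Sat weak (fin n) π i (R ψ (or φ ψ))
  until⇔release i φ ψ = mk⇔ until⇒release release⇒until
    where
    until⇒release : Sat weak (fin n) π i (U φ ψ) → Sat weak (fin n) π i (R ψ (or φ ψ))
    until⇒release (k , i≤k , sψ , gap) (k′ , i≤k′ , ¬φ∨ψ , ¬ψ) with <-cmp k k′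
    ... | tri< k<k′ _ _ = ¬ψ k i≤k k<k′ sψ
    ... | tri≈ _ refl _ = ¬φ∨ψ (inj₂ sψ)
    ... | tri> _ _ k′<k = ¬φ∨ψ (inj₁ (gap k′ i≤k′ k′<k))

    release⇒until : Sat weak (fin n) π i (R ψ (or φ ψ)) → Sat weak (fin n) π i (U φ ψ)
    release⇒until release with first-from (λ l → Sat? weak l ψ) i (suc (i + n))
    ... | inj₂ none = ⊥-elim (none (i + n) (m≤m+n i n) ≤-refl (weak-past-end ψ (m≤n+m n i)))
    ... | inj₁ (k , i≤k , _ , sψ , before) = k , i≤k , sψ , gap
      where
      gap : ∀ l → i ≤ l → l < k → Sat weak (fin n) π l φ
      gap l i≤l l<k with Sat? weak l φ
      ... | yes sφ = sφ
      ... | no ¬sφ = ⊥-elim (release (l , i≤l , [ ¬sφ , before l i≤l l<k ] ,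
                                      λ l′ i≤l′ l′<l → before l′ i≤l′ (<-trans l′<l l<k)))

  weak⇔W2S : ∀ (φ : NNF D VI VO) i → Sat weak (fin n) π i ⌜ φ ⌝ ⇔ Sat weak (fin n) π i ⌜ W2S φ ⌝
  weak⇔W2S (npred P ts) i = ⇔-id _
  weak⇔W2S (nnegpred P ts) i = ⇔-id _
  weak⇔W2S (nor φ ψ) i = weak⇔W2S φ i ⊎-⇔ weak⇔W2S ψ i
  weak⇔W2S (nand φ ψ) i = weak⇔W2S φ i ×-⇔ weak⇔W2S ψ i
  weak⇔W2S (nX φ) i = weak⇔W2S φ (suc i)
  weak⇔W2S (nY φ) zero = ⇔-id _
  weak⇔W2S (nY φ) (suc i) = ⇔-id _ ⊎-⇔ weak⇔W2S φ i
  weak⇔W2S (nU φ ψ) i =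
    until⇔release i ⌜ W2S φ ⌝ ⌜ W2S ψ ⌝ ⇔-∘ witness-cong-⇔ (λ l → weak⇔W2S φ l) (λ k → weak⇔W2S ψ k)
  weak⇔W2S (nR φ ψ) i =
    ¬-cong-⇔ (witness-cong-⇔ (λ l → ¬-cong-⇔ (weak⇔W2S φ l)) (λ k → ¬-cong-⇔ (weak⇔W2S ψ k)))

theorem3p8 : {D VI VO : Set} (δ : Term D VI VO → D) (φ : NNF D VI VO) (π : Trace D VI VO) →
    (Truncated._⊨t-_ δ (inf , π) ⌜ φ ⌝ ⇔ LTL._⊨LTL_ δ π ⌜ φ ⌝)
    × ((n : ℕ) → 1 ≤ n →
        (Truncated._⊨t-_ δ (fin n , π) ⌜ φ ⌝ ⇔ Truncated._⊨t-_ δ (fin n , π) ⌜ W2S φ ⌝))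
theorem3p8 δ φ π =
  Infinite.truncated⇔LTL δ π weak 0 ⌜ φ ⌝ ,
  λ n _ → Finite.weak⇔W2S δ π n φ 0
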